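{- Let $L$ be a finite geometric lattice and $x\in L$, and let $S$ be a set of atoms of $L$. Then the following are equivalent: (1) $S\in\mathfrak{I}_L(x)$; (2) $S$ is a maximal independent set of atoms of $[0,x]$; (3) $S$ is an independent set of atoms of $L$ and $\bigvee S=x$.
   Context: A geometric lattice is a semimodular atomistic lattice of finite length. For a finite poset $P$ with least element $0$, $\ell(x)$ denotes the length of the interval $[0,x]$ (the maximal $n$ such that $[0,x]$ contains an $(n+1)$-element chain), atoms are the elements covering $0$, and $A(x)$ denotes the set of atoms below $x$. For a finite lattice $L$ with least element $0$ in which $x<y$ implies $A(x)\subsetneq A(y)$ and incomparable elements have mutually non-included atom sets (e.g. a finite geometric lattice), the independent function $\mathfrak{I}_L$ assigns to each $x\in L$ a family of subsets of the atom set, defined recursively by: $\mathfrak{I}_L(x)=\{\emptyset\}$ if $\ell(x)=0$, and if $\ell(x)\geq 1$, $\mathfrak{I}_L(x)=\{S\cup\{a\}: S\in\mathfrak{I}_L(y),\ a\in A(x)\setminus A(y),\ y\prec x,\ \ell(x)=\ell(y)+1\}$. A set $S$ of atoms of a geometric lattice is independent in the usual sense: $a\not\leq\bigvee(S\setminus\{a\})$ for every $a\in S$ (equivalently, $\ell(\bigvee S)=|S|$). -}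

module Defs where

open import Data.Nat using (ℕ; zero; suc)
import Data.Nat as ℕ
open import Data.Fin using (Fin; inject₁) renaming (suc to fsuc)
open import Data.Fin.Subset using (Subset; _∈_; _∉_; _⊆_; _∪_; ⁅_⁆; _-_)
  renaming (⊥ to ∅)
open import Data.Fin.Subset.Properties using (_∈?_)
open import Data.List using (List; foldr; filter)
open import Data.List.Base using (allFin)
open import Data.Product using (Σ; ∃; _×_; _,_)
open import Relation.Nullary using (¬_)
open import Relation.Binary.PropositionalEquality using (_≡_)
open import Relation.Binary.Core using (Rel)
open import Relation.Binary.Definitions using (Minimum)
open import Relation.Binary.Lattice.Structures using (IsLattice)
open import Level using (0ℓ)
open import Data.Empty using (⊥)

-- A finite lattice, with carrier (up to isomorphism) Fin n and
-- equality _≡_ ; the order-theoretic lattice structure is the stdlib one.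
record FiniteLattice (n : ℕ) : Set₁ where
  field
    _≤_       : Rel (Fin n) 0ℓ
    _∨_       : Fin n → Fin n → Fin n
    _∧_       : Fin n → Fin n → Fin n
    isLattice : IsLattice _≡_ _≤_ _∨_ _∧_
    𝟘         : Fin n
    𝟘-least   : Minimum _≤_ 𝟘

  _<_ : Rel (Fin n) 0ℓ
  x < y = x ≤ y × ¬ (x ≡ y)

  _≺_ : Rel (Fin n) 0ℓ
  x ≺ y = x < y × (∀ z → x < z → z < y → ⊥)

  Atom : Fin n → Set
  Atom a = 𝟘 ≺ a

  AtomBelow : Fin n → Fin n → Set
  AtomBelow x a = Atom a × a ≤ x

  HasChain : Fin n → ℕ → Set
  HasChain x k = Σ (Fin (suc k) → Fin n) λ c →
    (∀ (i : Fin k) → c (inject₁ i) < c (fsuc i)) ×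
    (∀ i → 𝟘 ≤ c i × c i ≤ x)

  Len : Fin n → ℕ → Set
  Len x k = HasChain x k × (∀ m → HasChain x m → m ℕ.≤ k)

  ⋁ : Subset n → Fin n
  ⋁ S = foldr _∨_ 𝟘 (filter (_∈? S) (allFin n))

  AtomSet : Subset n → Set
  AtomSet S = ∀ a → a ∈ S → Atom a

  Independent : Subset n → Set
  Independent S = ∀ a → a ∈ S → ¬ (a ≤ ⋁ (S - a))

  -- S is an independent set of atoms of the interval [0,x]
  -- (atoms of [0,x] are exactly the atoms of L below x, and joins in
  -- [0,x] of such sets coincide with joins in L)
  IndepIn : Fin n → Subset n → Set
  IndepIn x S = (∀ a → a ∈ S → AtomBelow x a) × Independent S

  MaxIndepIn : Fin n → Subset n → Set
  MaxIndepIn x S = IndepIn x S × (∀ T → IndepIn x T → S ⊆ T → T ≡ S)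

  -- the independent function 𝔍_L, as the (inductive) family
  -- 𝔍 x S  ⟺  S ∈ 𝔍_L(x)
  data 𝔍 : Fin n → Subset n → Set where
    base : ∀ {x} → Len x 0 → 𝔍 x ∅
    step : ∀ {x y S a k} → Len y k → Len x (suc k) → y ≺ x →
           𝔍 y S → AtomBelow x a → ¬ (a ≤ y) →
           𝔍 x (S ∪ ⁅ a ⁆)

-- A finite geometric lattice: semimodular and atomistic
-- (finite length is automatic from finiteness).
record FiniteGeometricLattice (n : ℕ) : Set₁ where
  field
    lattice : FiniteLattice n
  open FiniteLattice lattice public
  field
    semimodular : ∀ x y → (x ∧ y) ≺ x → y ≺ (x ∨ y)
    atomistic : ∀ x u → (∀ a → AtomBelow x a → a ≤ u) → x ≤ u

-- Semimodularity gives z ≺ z ∨ a for every atom a ≰ z.  This yields the exchange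
-- property, so adding an atom outside the span of an independent set keeps it
-- independent; with atomisticity, the maximal independent sets of atoms below x are
-- exactly the independent S with ⋁ S = x.  Unfolding 𝔍 adds one atom along a cover at
-- a time, which gives (1) ⇒ (3).  For (3) ⇒ (1) one needs ℓ(⋁ S) = ∣ S ∣: removing the
-- atoms of S one by one gives a chain of covers of that length, and no chain below
-- ⋁ S is longer, since joining a chain with an atom shortens it by at most one step.

module Submission where

open import Defs
open import Data.Nat using (ℕ; zero; suc; z≤n; s≤s) renaming (_≤_ to _≤ℕ_; _<_ to _<ℕ_)
import Data.Nat.Properties as Nat
open import Data.Nat.Induction using (<-wellFounded)
open import Data.Fin using (Fin; _≟_; inject₁; fromℕ) renaming (zero to fzero; suc to fsuc)
open import Data.Fin.Subset
  using (Subset; _∈_; _∉_; _⊆_; _∪_; _-_; ⁅_⁆; inside; outside; ∣_∣) renaming (⊥ to ∅)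
open import Data.Fin.Subset.Properties
  using (_∈?_; nonempty?; Empty-unique; ∉⊥; ∣⊥∣≡0; x∈⁅x⁆; x∈⁅y⁆⇒x≡y; x∈p∪q⁺; x∈p∪q⁻;
         p⊆p∪q; ⊆-antisym; p─⊥≡p; p─q⊆p; x∈p∧x≢y⇒x∈p-y; x∈p⇒∣p-x∣<∣p∣)
open import Data.Vec using (_∷_; here; there)
open import Data.List using (foldr; filter; allFin) renaming (_∷_ to _∷ₗ_; [] to []ₗ)
import Data.List.Membership.Propositional as List
open import Data.List.Membership.Propositional.Properties using (∈-filter⁺; ∈-filter⁻; ∈-allFin)
import Data.List.Relation.Unary.Any as Any
open import Data.Product using (Σ; ∃-syntax; _×_; _,_; proj₁; proj₂)
open import Data.Sum using (_⊎_; inj₁; inj₂)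
open import Function.Base using (_∘_)
open import Function.Bundles using (_⇔_; mk⇔)
open import Induction.WellFounded using (module All)
open import Level using (0ℓ)
open import Relation.Binary.Construct.On as On using ()
open import Relation.Binary.Lattice.Bundles using (JoinSemilattice)
open import Relation.Binary.Lattice.Structures using (IsLattice)
open import Relation.Nullary using (¬_; Dec; yes; no; contradiction)
open import Relation.Binary.PropositionalEquality
  using (_≡_; _≢_; refl; sym; trans; cong; subst; subst₂; module ≡-Reasoning)

x∉p-x : ∀ {n} (x : Fin n) (p : Subset n) → x ∉ p - x
x∉p-x (fsuc x) (_ ∷ p) (there x∈p-x) = x∉p-x x p x∈p-x

x∈p-y⇒x≢y : ∀ {n} {x y : Fin n} {p : Subset n} → x ∈ p - y → x ≢ y
x∈p-y⇒x≢y {x = x} {p = p} x∈p-x refl = x∉p-x x p x∈p-x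

x∈p⇒∣p∣≡1+∣p-x∣ : ∀ {n} {x : Fin n} {p : Subset n} → x ∈ p → ∣ p ∣ ≡ suc ∣ p - x ∣
x∈p⇒∣p∣≡1+∣p-x∣ {p = inside ∷ p}  here        = cong (suc ∘ ∣_∣) (sym (p─⊥≡p p))
x∈p⇒∣p∣≡1+∣p-x∣ {p = inside ∷ p}  (there x∈p) = cong suc (x∈p⇒∣p∣≡1+∣p-x∣ x∈p)
x∈p⇒∣p∣≡1+∣p-x∣ {p = outside ∷ p} (there x∈p) = x∈p⇒∣p∣≡1+∣p-x∣ x∈p

x∈p∪⁅y⁆⇒x∈p⊎x≡y : ∀ {n} {x y : Fin n} {p : Subset n} → x ∈ p ∪ ⁅ y ⁆ → x ∈ p ⊎ x ≡ y
x∈p∪⁅y⁆⇒x∈p⊎x≡y {y = y} {p} x∈p∪⁅y⁆ with x∈p∪q⁻ p ⁅ y ⁆ x∈p∪⁅y⁆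
... | inj₁ x∈p    = inj₁ x∈p
... | inj₂ x∈⁅y⁆ = inj₂ (x∈⁅y⁆⇒x≡y y x∈⁅y⁆)

y∈p∪⁅y⁆ : ∀ {n} (y : Fin n) (p : Subset n) → y ∈ p ∪ ⁅ y ⁆
y∈p∪⁅y⁆ y p = x∈p∪q⁺ (inj₂ (x∈⁅x⁆ y))

x∈p⇒p-x∪⁅x⁆≡p : ∀ {n} {x : Fin n} {p : Subset n} → x ∈ p → (p - x) ∪ ⁅ x ⁆ ≡ p
x∈p⇒p-x∪⁅x⁆≡p {x = x} {p} x∈p = ⊆-antisym ⊆p p⊆
  where
  ⊆p : (p - x) ∪ ⁅ x ⁆ ⊆ p
  ⊆p y∈ with x∈p∪⁅y⁆⇒x∈p⊎x≡y y∈
  ... | inj₁ y∈p-x = p─q⊆p p ⁅ x ⁆ y∈p-x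
  ... | inj₂ refl   = x∈p
  p⊆ : p ⊆ (p - x) ∪ ⁅ x ⁆
  p⊆ {y} y∈p with y ≟ x
  ... | yes refl = y∈p∪⁅y⁆ y (p - y)
  ... | no  y≢x  = x∈p∪q⁺ (inj₁ (x∈p∧x≢y⇒x∈p-y y∈p y≢x))

p⊆q⇒p-x⊆q-x : ∀ {n} {x : Fin n} {p q : Subset n} → p ⊆ q → p - x ⊆ q - x
p⊆q⇒p-x⊆q-x {p = p} p⊆q y∈p-x =
  x∈p∧x≢y⇒x∈p-y (p⊆q (p─q⊆p p _ y∈p-x)) (x∈p-y⇒x≢y y∈p-x)

[p∪⁅x⁆]-x⊆p : ∀ {n} {x : Fin n} {p : Subset n} → (p ∪ ⁅ x ⁆) - x ⊆ p
[p∪⁅x⁆]-x⊆p {p = p} y∈ with x∈p∪⁅y⁆⇒x∈p⊎x≡y (p─q⊆p (p ∪ _) _ y∈)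
... | inj₁ y∈p  = y∈p
... | inj₂ refl = contradiction y∈ (x∉p-x _ _)

[p∪⁅x⁆]-y⊆[p-y]∪⁅x⁆ : ∀ {n} {x y : Fin n} {p : Subset n} → (p ∪ ⁅ x ⁆) - y ⊆ (p - y) ∪ ⁅ x ⁆
[p∪⁅x⁆]-y⊆[p-y]∪⁅x⁆ {x = x} {p = p} z∈ with x∈p∪⁅y⁆⇒x∈p⊎x≡y (p─q⊆p (p ∪ _) _ z∈)
... | inj₁ z∈p  = x∈p∪q⁺ (inj₁ (x∈p∧x≢y⇒x∈p-y z∈p (x∈p-y⇒x≢y z∈)))
... | inj₂ refl = y∈p∪⁅y⁆ x _

Subset-induction : ∀ {n} (P : Subset n → Set) → P ∅ →
                   (∀ {S x} → x ∈ S → P (S - x) → P S) → ∀ S → P S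
Subset-induction P P∅ P-step = All.wfRec (On.wellFounded ∣_∣ <-wellFounded) 0ℓ P step
  where
  step : ∀ S → (∀ {T} → ∣ T ∣ <ℕ ∣ S ∣ → P T) → P S
  step S rec with nonempty? S
  ... | no  S-empty    = subst P (sym (Empty-unique S-empty)) P∅
  ... | yes (x , x∈S) = P-step x∈S (rec (x∈p⇒∣p-x∣<∣p∣ x∈S))

module FiniteLatticeProperties {n : ℕ} (L : FiniteLattice n) where
  open FiniteLattice L
  open IsLattice isLattice
    using (x≤x∨y; y≤x∨y; ∨-least; x∧y≤x; x∧y≤y; antisym)
    renaming (refl to ≤-refl; trans to ≤-trans) public

  joinSemilattice : JoinSemilattice 0ℓ 0ℓ 0ℓ
  joinSemilattice = record { isJoinSemilattice = IsLattice.isJoinSemilattice isLattice }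

  open import Relation.Binary.Lattice.Properties.JoinSemilattice joinSemilattice
    using (∨-monotonic; ∨-comm; x≤y⇒x∨y≈y) public
  open import Relation.Binary.Properties.Poset (JoinSemilattice.poset joinSemilattice)
    using (<⇒≱) public

  _≤?_ : ∀ x y → Dec (x ≤ y)
  x ≤? y with x ∨ y ≟ y
  ... | yes x∨y≡y = yes (subst (x ≤_) x∨y≡y (x≤x∨y x y))
  ... | no  x∨y≢y = no λ x≤y → x∨y≢y (x≤y⇒x∨y≈y x≤y)

  <-≤-trans : ∀ {x y z} → x < y → y ≤ z → x < z
  <-≤-trans (x≤y , x≢y) y≤z = ≤-trans x≤y y≤z , λ { refl → x≢y (antisym x≤y y≤z) }

  ≤∨-absorb : ∀ {x y} → y ≤ x → x ∨ y ≡ x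
  ≤∨-absorb {x} {y} y≤x = trans (∨-comm x y) (x≤y⇒x∨y≈y y≤x)

  ≺-between : ∀ {x y z} → x ≺ y → x ≤ z → z ≤ y → z ≡ x ⊎ z ≡ y
  ≺-between {x} {y} {z} (_ , nothing-between) x≤z z≤y with z ≟ x | z ≟ y
  ... | yes z≡x | _       = inj₁ z≡x
  ... | no  _   | yes z≡y = inj₂ z≡y
  ... | no  z≢x | no  z≢y = contradiction (z≤y , z≢y) (nothing-between z (x≤z , z≢x ∘ sym))

  ≺-top : ∀ {x y z} → x ≺ y → x < z → z ≤ y → z ≡ y
  ≺-top x≺y (x≤z , x≢z) z≤y with ≺-between x≺y x≤z z≤y
  ... | inj₁ z≡x = contradiction (sym z≡x) x≢z
  ... | inj₂ z≡y = z≡y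

  Atom⇒∧≺ : ∀ {a z} → Atom a → ¬ (a ≤ z) → (a ∧ z) ≺ a
  Atom⇒∧≺ {a} {z} 𝟘≺a a≰z with ≺-between 𝟘≺a (𝟘-least (a ∧ z)) (x∧y≤x a z)
  ... | inj₁ a∧z≡𝟘 = subst (_≺ a) (sym a∧z≡𝟘) 𝟘≺a
  ... | inj₂ a∧z≡a = contradiction (subst (_≤ z) a∧z≡a (x∧y≤y a z)) a≰z

  AtomSet-⊆ : ∀ {S T} → AtomSet S → T ⊆ S → AtomSet T
  AtomSet-⊆ atoms T⊆S a a∈T = atoms a (T⊆S a∈T)

  ⋁-upper : ∀ {S a} → a ∈ S → a ≤ ⋁ S
  ⋁-upper {S} {a} a∈S = foldr-upper (∈-filter⁺ (_∈? S) (∈-allFin a) a∈S)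
    where
    foldr-upper : ∀ {xs} → a List.∈ xs → a ≤ foldr _∨_ 𝟘 xs
    foldr-upper (Any.here refl) = x≤x∨y _ _
    foldr-upper (Any.there a∈xs) = ≤-trans (foldr-upper a∈xs) (y≤x∨y _ _)

  ⋁-least : ∀ {S u} → (∀ {a} → a ∈ S → a ≤ u) → ⋁ S ≤ u
  ⋁-least {S} {u} bound =
    foldr-least _ (λ a∈xs → bound (proj₂ (∈-filter⁻ (_∈? S) {xs = allFin n} a∈xs)))
    where
    foldr-least : ∀ xs → (∀ {a} → a List.∈ xs → a ≤ u) → foldr _∨_ 𝟘 xs ≤ u
    foldr-least []ₗ        _     = 𝟘-least u
    foldr-least (x ∷ₗ xs) bound′ =
      ∨-least (bound′ (Any.here refl)) (foldr-least xs (bound′ ∘ Any.there))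

  ⋁-mono : ∀ {S T} → S ⊆ T → ⋁ S ≤ ⋁ T
  ⋁-mono S⊆T = ⋁-least (⋁-upper ∘ S⊆T)

  ⋁-∅ : ⋁ ∅ ≡ 𝟘
  ⋁-∅ = antisym (⋁-least (λ a∈∅ → contradiction a∈∅ ∉⊥)) (𝟘-least _)

  ⋁-∪⁅⁆ : ∀ S a → ⋁ (S ∪ ⁅ a ⁆) ≡ ⋁ S ∨ a
  ⋁-∪⁅⁆ S a = antisym (⋁-least below) (∨-least (⋁-mono (p⊆p∪q ⁅ a ⁆)) (⋁-upper (y∈p∪⁅y⁆ a S)))
    where
    below : ∀ {b} → b ∈ S ∪ ⁅ a ⁆ → b ≤ (⋁ S ∨ a)
    below b∈ with x∈p∪⁅y⁆⇒x∈p⊎x≡y b∈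
    ... | inj₁ b∈S = ≤-trans (⋁-upper b∈S) (x≤x∨y _ _)
    ... | inj₂ refl = y≤x∨y _ _

  ⋁-remove : ∀ {S a} → a ∈ S → ⋁ S ≡ ⋁ (S - a) ∨ a
  ⋁-remove {S} {a} a∈S = begin
    ⋁ S                  ≡⟨ cong ⋁ (sym (x∈p⇒p-x∪⁅x⁆≡p a∈S)) ⟩
    ⋁ ((S - a) ∪ ⁅ a ⁆)  ≡⟨ ⋁-∪⁅⁆ (S - a) a ⟩
    ⋁ (S - a) ∨ a        ∎
    where open ≡-Reasoning

  infixr 5 _◅_

  data Chain : Fin n → Fin n → ℕ → Set where
    ε   : ∀ {a} → Chain a a 0
    _◅_ : ∀ {a b c m} → a < b → Chain b c m → Chain a c (suc m)

  Chain-≤ : ∀ {a b m} → Chain a b m → a ≤ b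
  Chain-≤ ε           = ≤-refl
  Chain-≤ (a<b ◅ bc) = ≤-trans (proj₁ a<b) (Chain-≤ bc)

  Chain-< : ∀ {a b m} → Chain a b (suc m) → a < b
  Chain-< (a<b ◅ bc) = <-≤-trans a<b (Chain-≤ bc)

  Chain-snoc : ∀ {a b c m} → Chain a b m → b < c → Chain a c (suc m)
  Chain-snoc ε           b<c = b<c ◅ ε
  Chain-snoc (a<a′ ◅ ab) b<c = a<a′ ◅ Chain-snoc ab b<c

  Chain-lower-start : ∀ {a b c m} → c ≤ a → Chain a b m → ∃[ m′ ] m ≤ℕ m′ × Chain c b m′
  Chain-lower-start {a} {c = c} {m} c≤a ab with c ≟ a
  ... | yes refl = m , Nat.≤-refl , ab
  ... | no  c≢a  = suc m , Nat.n≤1+n m , (c≤a , c≢a) ◅ ab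

  Chain⇒HasChain : ∀ {x m} → Chain 𝟘 x m → HasChain x m
  Chain⇒HasChain = enumerate
    where
    enumerate : ∀ {a b m} → Chain a b m → Σ (Fin (suc m) → Fin n) λ c →
                (∀ i → c (inject₁ i) < c (fsuc i)) × (∀ i → a ≤ c i × c i ≤ b)
    enumerate {a} ε = (λ _ → a) , (λ ()) , λ _ → ≤-refl , ≤-refl
    enumerate {a} {b} (a<a′ ◅ a′b) with enumerate a′b
    ... | c , increasing , bounded = c′ , increasing′ , bounded′
      where
      c′ : Fin _ → Fin n
      c′ fzero    = a
      c′ (fsuc i) = c i
      increasing′ : ∀ i → c′ (inject₁ i) < c′ (fsuc i)
      increasing′ fzero    = <-≤-trans a<a′ (proj₁ (bounded fzero))
      increasing′ (fsuc i) = increasing i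
      bounded′ : ∀ i → a ≤ c′ i × c′ i ≤ b
      bounded′ fzero    = ≤-refl , Chain-≤ (a<a′ ◅ a′b)
      bounded′ (fsuc i) = ≤-trans (proj₁ a<a′) (proj₁ (bounded i)) , proj₂ (bounded i)

  increasing⇒Chain : ∀ m (c : Fin (suc m) → Fin n) → (∀ i → c (inject₁ i) < c (fsuc i)) →
                     Chain (c fzero) (c (fromℕ m)) m
  increasing⇒Chain zero    c increasing = ε
  increasing⇒Chain (suc m) c increasing =
    increasing fzero ◅ increasing⇒Chain m (c ∘ fsuc) (increasing ∘ fsuc)

  Len-0⇒≡𝟘 : ∀ {x} → Len x 0 → x ≡ 𝟘
  Len-0⇒≡𝟘 {x} (_ , maximal) with x ≟ 𝟘
  ... | yes x≡𝟘 = x≡𝟘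
  ... | no  x≢𝟘 with maximal 1 (Chain⇒HasChain ((𝟘-least x , x≢𝟘 ∘ sym) ◅ ε))
  ...   | ()

module GeometricLatticeProperties {n : ℕ} (G : FiniteGeometricLattice n) where
  open FiniteGeometricLattice G
  open FiniteLatticeProperties lattice

  ≺∨-atom : ∀ {a z} → Atom a → ¬ (a ≤ z) → z ≺ (z ∨ a)
  ≺∨-atom {a} {z} atom a≰z = subst (z ≺_) (∨-comm a z) (semimodular a z (Atom⇒∧≺ atom a≰z))

  exchange : ∀ {a b z} → Atom a → ¬ (b ≤ z) → b ≤ (z ∨ a) → a ≤ (z ∨ b)
  exchange {a} {b} {z} atom b≰z b≤z∨a with a ≤? z
  ... | yes a≤z = contradiction (subst (b ≤_) (≤∨-absorb a≤z) b≤z∨a) b≰z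
  ... | no  a≰z = subst (a ≤_) (sym z∨b≡z∨a) (y≤x∨y z a)
    where
    z<z∨b : z < (z ∨ b)
    z<z∨b = x≤x∨y z b , λ z≡z∨b → b≰z (subst (b ≤_) (sym z≡z∨b) (y≤x∨y z b))
    z∨b≡z∨a : z ∨ b ≡ z ∨ a
    z∨b≡z∨a = ≺-top (≺∨-atom atom a≰z) z<z∨b (∨-least (x≤x∨y z a) b≤z∨a)

  Independent-⊆ : ∀ {S T} → Independent S → T ⊆ S → Independent T
  Independent-⊆ indep T⊆S c c∈T c≤⋁[T-c] =
    indep c (T⊆S c∈T) (≤-trans c≤⋁[T-c] (⋁-mono (p⊆q⇒p-x⊆q-x T⊆S)))

  Independent-∪⁅⁆ : ∀ {S a} → Independent S → Atom a → ¬ (a ≤ ⋁ S) → Independent (S ∪ ⁅ a ⁆)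
  Independent-∪⁅⁆ {S} {a} indep atom a≰⋁S c c∈ c≤⋁ with x∈p∪⁅y⁆⇒x∈p⊎x≡y c∈
  ... | inj₂ refl = a≰⋁S (≤-trans c≤⋁ (⋁-mono [p∪⁅x⁆]-x⊆p))
  ... | inj₁ c∈S  = a≰⋁S (subst (a ≤_) (sym (⋁-remove c∈S)) (exchange atom (indep c c∈S) c≤⋁[S-c]∨a))
    where
    c≤⋁[S-c]∨a : c ≤ (⋁ (S - c) ∨ a)
    c≤⋁[S-c]∨a = subst (c ≤_) (⋁-∪⁅⁆ (S - c) a) (≤-trans c≤⋁ (⋁-mono [p∪⁅x⁆]-y⊆[p-y]∪⁅x⁆))

  -- If s ≤ a′ the tail a′ … b is unchanged by joining with s; otherwise a ≺ a ∨ s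
  -- keeps the first step a ∨ s < a′ ∨ s strict.
  Chain-∨-atom : ∀ {s a b m} → Atom s → Chain a b m → ∃[ m′ ] m ≤ℕ suc m′ × Chain (a ∨ s) (b ∨ s) m′
  Chain-∨-atom atom ε = 0 , z≤n , ε
  Chain-∨-atom {s} atom (_◅_ {a} {a′} {b} a<a′ a′b) with s ≤? a′
  ... | yes s≤a′ with Chain-lower-start (∨-least (proj₁ a<a′) s≤a′) a′b
  ...   | m′ , m≤m′ , chain = m′ , s≤s m≤m′ , subst (λ y → Chain (a ∨ s) y m′) b≡b∨s chain
    where
    b≡b∨s : b ≡ b ∨ s
    b≡b∨s = sym (≤∨-absorb (≤-trans s≤a′ (Chain-≤ a′b)))
  Chain-∨-atom {s} atom (_◅_ {a} {a′} {b} a<a′ a′b) | no s≰a′ with Chain-∨-atom atom a′b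
  ... | m′ , m≤1+m′ , chain =
    suc m′ , s≤s m≤1+m′ , (∨-monotonic (proj₁ a<a′) ≤-refl , a∨s≢a′∨s) ◅ chain
    where
    a∨s≢a′∨s : a ∨ s ≢ a′ ∨ s
    a∨s≢a′∨s a∨s≡a′∨s = s≰a′ (subst (s ≤_) (sym a′≡a∨s) (y≤x∨y a s))
      where
      a′≡a∨s : a′ ≡ a ∨ s
      a′≡a∨s = ≺-top (≺∨-atom atom (λ s≤a → s≰a′ (≤-trans s≤a (proj₁ a<a′)))) a<a′
                     (subst (a′ ≤_) (sym a∨s≡a′∨s) (x≤x∨y a′ s))

  Chain-length≤∣S∣ : ∀ S → AtomSet S → ∀ {a b m} → Chain a b m → b ≤ (a ∨ ⋁ S) → m ≤ℕ ∣ S ∣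
  Chain-length≤∣S∣ = Subset-induction P case-∅ case-remove
    where
    P : Subset n → Set
    P S = AtomSet S → ∀ {a b m} → Chain a b m → b ≤ (a ∨ ⋁ S) → m ≤ℕ ∣ S ∣
    case-∅ : P ∅
    case-∅ _ ε _ = z≤n
    case-∅ _ {a} chain@(_ ◅ _) b≤a∨⋁∅ = contradiction b≤a (<⇒≱ (Chain-< chain))
      where
      b≤a : _ ≤ a
      b≤a = subst (_ ≤_) (trans (cong (a ∨_) ⋁-∅) (≤∨-absorb (𝟘-least a))) b≤a∨⋁∅
    case-remove : ∀ {S s} → s ∈ S → P (S - s) → P S
    case-remove {S} {s} s∈S ih atoms {a} {b} chain b≤a∨⋁S with Chain-∨-atom (atoms s s∈S) chain
    ... | m′ , m≤1+m′ , chain′ =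
      Nat.≤-trans m≤1+m′ (subst (suc m′ ≤ℕ_) (sym (x∈p⇒∣p∣≡1+∣p-x∣ s∈S))
                            (s≤s (ih (AtomSet-⊆ atoms (p─q⊆p S _)) chain′ b∨s≤)))
      where
      top : Fin n
      top = (a ∨ s) ∨ ⋁ (S - s)
      s≤top : s ≤ top
      s≤top = ≤-trans (y≤x∨y a s) (x≤x∨y _ _)
      ⋁S≤top : ⋁ S ≤ top
      ⋁S≤top = subst (_≤ top) (sym (⋁-remove s∈S)) (∨-least (y≤x∨y _ _) s≤top)
      b∨s≤ : (b ∨ s) ≤ top
      b∨s≤ = ∨-least (≤-trans b≤a∨⋁S (∨-least (≤-trans (x≤x∨y a s) (x≤x∨y _ _)) ⋁S≤top)) s≤top

  ⋁-remove-≺ : ∀ {S a} → AtomSet S → Independent S → a ∈ S → ⋁ (S - a) ≺ ⋁ S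
  ⋁-remove-≺ {S} {a} atoms indep a∈S =
    subst (⋁ (S - a) ≺_) (sym (⋁-remove a∈S)) (≺∨-atom (atoms a a∈S) (indep a a∈S))

  Independent⇒Chain : ∀ S → AtomSet S → Independent S → Chain 𝟘 (⋁ S) ∣ S ∣
  Independent⇒Chain = Subset-induction P case-∅ case-remove
    where
    P : Subset n → Set
    P S = AtomSet S → Independent S → Chain 𝟘 (⋁ S) ∣ S ∣
    case-∅ : P ∅
    case-∅ _ _ = subst₂ (Chain 𝟘) (sym ⋁-∅) (sym (∣⊥∣≡0 n)) ε
    case-remove : ∀ {S a} → a ∈ S → P (S - a) → P S
    case-remove {S} {a} a∈S ih atoms indep =
      subst (Chain 𝟘 (⋁ S)) (sym (x∈p⇒∣p∣≡1+∣p-x∣ a∈S))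
        (Chain-snoc (ih (AtomSet-⊆ atoms (p─q⊆p S _)) (Independent-⊆ indep (p─q⊆p S _)))
                    (proj₁ (⋁-remove-≺ atoms indep a∈S)))

  Independent⇒Len : ∀ {S} → AtomSet S → Independent S → Len (⋁ S) ∣ S ∣
  Independent⇒Len {S} atoms indep = Chain⇒HasChain (Independent⇒Chain S atoms indep) , bounded
    where
    bounded : ∀ m → HasChain (⋁ S) m → m ≤ℕ ∣ S ∣
    bounded m (c , increasing , within) =
      Chain-length≤∣S∣ S atoms (increasing⇒Chain m c increasing)
                       (≤-trans (proj₂ (within (fromℕ m))) (y≤x∨y _ _))

  Independent⇒𝔍 : ∀ S → AtomSet S → Independent S → 𝔍 (⋁ S) S
  Independent⇒𝔍 = Subset-induction P case-∅ case-remove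
    where
    P : Subset n → Set
    P S = AtomSet S → Independent S → 𝔍 (⋁ S) S
    case-∅ : P ∅
    case-∅ atoms indep = base (subst (Len (⋁ ∅)) (∣⊥∣≡0 n) (Independent⇒Len atoms indep))
    case-remove : ∀ {S a} → a ∈ S → P (S - a) → P S
    case-remove {S} {a} a∈S ih atoms indep =
      subst (𝔍 (⋁ S)) (x∈p⇒p-x∪⁅x⁆≡p a∈S)
        (step (Independent⇒Len atoms′ indep′)
              (subst (Len (⋁ S)) (x∈p⇒∣p∣≡1+∣p-x∣ a∈S) (Independent⇒Len atoms indep))
              (⋁-remove-≺ atoms indep a∈S) (ih atoms′ indep′)
              (atoms a a∈S , ⋁-upper a∈S) (indep a a∈S))
      where
      atoms′ : AtomSet (S - a)
      atoms′ = AtomSet-⊆ atoms (p─q⊆p S _)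
      indep′ : Independent (S - a)
      indep′ = Independent-⊆ indep (p─q⊆p S _)

  𝔍⇒Independent×⋁≡ : ∀ {x S} → 𝔍 x S → Independent S × ⋁ S ≡ x
  𝔍⇒Independent×⋁≡ (base ℓx≡0) = (λ a a∈∅ _ → ∉⊥ a∈∅) , trans ⋁-∅ (sym (Len-0⇒≡𝟘 ℓx≡0))
  𝔍⇒Independent×⋁≡ {x} (step {S = S} {a = a} _ _ y≺x 𝔍yS (atom , a≤x) a≰y)
    with 𝔍⇒Independent×⋁≡ 𝔍yS
  ... | indep , refl = Independent-∪⁅⁆ indep atom a≰y , ⋁S∪⁅a⁆≡x
    where
    open ≡-Reasoning
    ⋁S∪⁅a⁆≡x : ⋁ (S ∪ ⁅ a ⁆) ≡ x
    ⋁S∪⁅a⁆≡x = begin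
      ⋁ (S ∪ ⁅ a ⁆) ≡⟨ ⋁-∪⁅⁆ S a ⟩
      ⋁ S ∨ a       ≡⟨ ≺-top y≺x (proj₁ (≺∨-atom atom a≰y)) (∨-least (proj₁ (proj₁ y≺x)) a≤x) ⟩
      x             ∎

  Independent⇒MaxIndepIn : ∀ {S} → AtomSet S → Independent S → MaxIndepIn (⋁ S) S
  Independent⇒MaxIndepIn {S} atoms indep = ((λ a a∈S → atoms a a∈S , ⋁-upper a∈S) , indep) , maximal
    where
    maximal : ∀ T → IndepIn (⋁ S) T → S ⊆ T → T ≡ S
    maximal T (T-below , T-indep) S⊆T = ⊆-antisym T⊆S S⊆T
      where
      T⊆S : T ⊆ S
      T⊆S {t} t∈T with t ∈? S
      ... | yes t∈S = t∈S
      ... | no  t∉S = contradiction (≤-trans (proj₂ (T-below t t∈T)) (⋁-mono S⊆T-t)) (T-indep t t∈T)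
        where
        S⊆T-t : S ⊆ T - t
        S⊆T-t s∈S = x∈p∧x≢y⇒x∈p-y (S⊆T s∈S) λ { refl → t∉S s∈S }

  MaxIndepIn⇒⋁≡ : ∀ {x S} → MaxIndepIn x S → ⋁ S ≡ x
  MaxIndepIn⇒⋁≡ {x} {S} ((below , indep) , maximal) =
    antisym (⋁-least (λ {a} a∈S → proj₂ (below a a∈S))) (atomistic x (⋁ S) spanned)
    where
    spanned : ∀ a → AtomBelow x a → a ≤ ⋁ S
    spanned a (atom , a≤x) with a ≤? ⋁ S
    ... | yes a≤⋁S = a≤⋁S
    ... | no  a≰⋁S = ⋁-upper (subst (a ∈_) S∪⁅a⁆≡S (y∈p∪⁅y⁆ a S))
      where
      below′ : ∀ b → b ∈ S ∪ ⁅ a ⁆ → AtomBelow x b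
      below′ b b∈ with x∈p∪⁅y⁆⇒x∈p⊎x≡y b∈
      ... | inj₁ b∈S  = below b b∈S
      ... | inj₂ refl = atom , a≤x
      S∪⁅a⁆≡S : S ∪ ⁅ a ⁆ ≡ S
      S∪⁅a⁆≡S = maximal (S ∪ ⁅ a ⁆) (below′ , Independent-∪⁅⁆ indep atom a≰⋁S) (p⊆p∪q ⁅ a ⁆)

lemma2p4 : ∀ {n} (L : FiniteGeometricLattice n) (x : Fin n) (S : Subset n) →
    FiniteGeometricLattice.AtomSet L S →
    (FiniteGeometricLattice.𝔍 L x S ⇔ FiniteGeometricLattice.MaxIndepIn L x S)
    × (FiniteGeometricLattice.MaxIndepIn L x S
       ⇔ (FiniteGeometricLattice.Independent L S × FiniteGeometricLattice.⋁ L S ≡ x))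
lemma2p4 L x S atoms = mk⇔ (3⇒2 ∘ 𝔍⇒Independent×⋁≡) 2⇒1 , mk⇔ 2⇒3 3⇒2
  where
  open FiniteGeometricLattice L
  open GeometricLatticeProperties L
  3⇒2 : Independent S × ⋁ S ≡ x → MaxIndepIn x S
  3⇒2 (indep , refl) = Independent⇒MaxIndepIn atoms indep
  2⇒3 : MaxIndepIn x S → Independent S × ⋁ S ≡ x
  2⇒3 max = proj₂ (proj₁ max) , MaxIndepIn⇒⋁≡ max
  2⇒1 : MaxIndepIn x S → 𝔍 x S
  2⇒1 max = subst (λ y → 𝔍 y S) (MaxIndepIn⇒⋁≡ max) (Independent⇒𝔍 S atoms (proj₂ (proj₁ max)))
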